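{- Let $G$ be an Eulerian graph on an even number $n$ of vertices, and let $A$ be its adjacency matrix regarded over $\mathbb{F}_2$. Let $\mathbb{F}$ be the splitting field over $\mathbb{F}_2$ of the characteristic polynomial of $A$, and let $A=PJP^{ -1}$ with $P\in M_{n\times n}(\mathbb{F})$ invertible and $J=\mathrm{diag}(J_1,\ldots,J_t)$ a Jordan normal form of $A$ over $\mathbb{F}$, where $J_i$ is the $\ell_i\times\ell_i$ Jordan block with eigenvalue $\lambda_i$ (so, writing the columns of $P$ as $\alpha_{11},\ldots,\alpha_{1\ell_1},\ldots,\alpha_{t1},\ldots,\alpha_{t\ell_t}$, we have $A\alpha_{i1}=\lambda_i\alpha_{i1}$ and $A\alpha_{i,k+1}=\lambda_i\alpha_{i,k+1}+\alpha_{ik}$ for $1\le k<\ell_i$), and where $\alpha_{11}=e$ is the all-one vector. Let $Q=P^{\rm T}P$, partitioned into blocks $Q_{ij}$ (of size $\ell_i\times\ell_j$) conformally with $J$, so that the $(j,k)$ entry of $Q_{ii}$ is $\alpha_{ij}^{\rm T}\alpha_{ik}$. If $\lambda_i\neq 0$, then $Q_{ii}=0$.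
   Context: An Eulerian graph is a connected graph in which every vertex has even degree. Since all degrees are even, $Ae=0$ over $\mathbb{F}_2$, so $e$ can be chosen as the first column of $P$ in a Jordan block for eigenvalue $0$. -}

module Defs where

open import Level using (Level; _⊔_)
open import Data.Nat using (ℕ; zero; suc)
open import Data.Nat.Divisibility using (_∣_)
open import Data.Fin using (Fin; zero; suc; inject₁)
open import Data.Bool using (Bool; true; false; if_then_else_)
open import Data.List using (List; []; _∷_; length; filter)
open import Data.List.Base using (allFin)
open import Data.Product using (Σ; _,_; _×_; ∃-syntax)
open import Relation.Nullary using (¬_)
open import Relation.Binary.PropositionalEquality using (_≡_; _≢_)
open import Algebra.Bundles using (CommutativeRing)

record SimpleGraph (n : ℕ) : Set where
  field
    adj     : Fin n → Fin n → Bool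
    symm    : ∀ i j → adj i j ≡ adj j i
    irrefl  : ∀ i → adj i i ≡ false

module _ {n : ℕ} (G : SimpleGraph n) where
  open SimpleGraph G

  neighbours : Fin n → List (Fin n)
  neighbours i = filter (λ j → adj i j Data.Bool.≟ true) (allFin n)

  degree : Fin n → ℕ
  degree i = length (neighbours i)

  data Walk : Fin n → Fin n → Set where
    here : ∀ {u} → Walk u u
    step : ∀ {u w v} → adj u w ≡ true → Walk w v → Walk u v

  Connected : Set
  Connected = ∀ u v → Walk u v

  Eulerian : Set
  Eulerian = Connected × (∀ i → 2 ∣ degree i)

record Field (c ℓ : Level) : Set (Level.suc (c ⊔ ℓ)) where
  field
    commutativeRing : CommutativeRing c ℓ
  open CommutativeRing commutativeRing public
  field
    0≉1     : ¬ (0# ≈ 1#)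
    inverse : ∀ x → ¬ (x ≈ 0#) → ∃[ y ] (x * y ≈ 1#)

module LinAlg {c ℓ : Level} (F : Field c ℓ) where
  open Field F public using (Carrier; _≈_; _+_; _*_; 0#; 1#)

  Char2 : Set ℓ
  Char2 = 1# + 1# ≈ 0#

  ∑ : ∀ {m} → (Fin m → Carrier) → Carrier
  ∑ {zero}  f = 0#
  ∑ {suc m} f = f zero + ∑ (λ i → f (suc i))

  Vector : ℕ → Set c
  Vector n = Fin n → Carrier

  _≈ᵛ_ : ∀ {n} → Vector n → Vector n → Set ℓ
  u ≈ᵛ v = ∀ i → u i ≈ v i

  _+ᵛ_ : ∀ {n} → Vector n → Vector n → Vector n
  (u +ᵛ v) i = u i + v i

  _·ᵛ_ : ∀ {n} → Carrier → Vector n → Vector n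
  (a ·ᵛ v) i = a * v i

  dot : ∀ {n} → Vector n → Vector n → Carrier
  dot u v = ∑ (λ i → u i * v i)

  ones : ∀ {n} → Vector n
  ones _ = 1#

  _⊛_ : ∀ {n} → (Fin n → Fin n → Carrier) → Vector n → Vector n
  (M ⊛ v) i = ∑ (λ j → M i j * v j)

  -- the adjacency matrix of G, with F_2-entries viewed inside F
  adjMatrix : ∀ {n} → SimpleGraph n → Fin n → Fin n → Carrier
  adjMatrix G i j = if SimpleGraph.adj G i j then 1# else 0#

  -- Jordan data: t blocks; block i has size (suc (ℓs i)) and eigenvalue
  -- λs i; the columns of P are α i k, for k : Fin (suc (ℓs i)).
  -- Column index set of P:
  Idx : (t : ℕ) → (Fin t → ℕ) → Set
  Idx t ℓs = Σ (Fin t) (λ i → Fin (suc (ℓs i)))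

  ∑Idx : ∀ {t} (ℓs : Fin t → ℕ) → (Idx t ℓs → Carrier) → Carrier
  ∑Idx ℓs f = ∑ (λ i → ∑ (λ k → f (i , k)))

  Invertible : ∀ {n t} (ℓs : Fin t → ℕ) →
               (Idx t ℓs → Vector n) → Set (c ⊔ ℓ)
  Invertible {n} {t} ℓs P =
    Σ (Idx t ℓs → Vector n) λ R →
      ((∀ a → ∑Idx ℓs (λ x → P x a * R x a) ≈ 1#) ×
       (∀ a b → a ≢ b → ∑Idx ℓs (λ x → P x a * R x b) ≈ 0#)) ×
      ((∀ x → ∑ (λ a → R x a * P x a) ≈ 1#) ×
       (∀ x y → x ≢ y → ∑ (λ a → R x a * P y a) ≈ 0#))

  -- A = P J P⁻¹ with J = diag(J_1,…,J_t), J_i the Jordan block of size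
  -- suc (ℓs i) with eigenvalue λs i; equivalently (given P invertible)
  -- A P = P J, i.e. the Jordan chain relations on the columns.
  IsJordanChain : ∀ {n} → (Fin n → Fin n → Carrier) → Carrier → ∀ {m} →
                  (Fin (suc m) → Vector n) → Set ℓ
  IsJordanChain A λ' α =
    ((A ⊛ α zero) ≈ᵛ (λ' ·ᵛ α zero)) ×
    (∀ k → (A ⊛ α (suc k)) ≈ᵛ ((λ' ·ᵛ α (suc k)) +ᵛ α (inject₁ k)))

-- Over characteristic 2 the adjacency matrix A is symmetric with zero diagonal, so
-- xᵀ(Ay) = (Ax)ᵀy and xᵀAx = 0, and even degrees give Ae = 0. Along a Jordan chain
-- α₀, …, α_ℓ for λ ≠ 0, applying eᵀ to Aα₀ = λα₀ and Aα_{k+1} = λα_{k+1} + α_k gives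
-- eᵀα_k = 0 for all k, hence α_kᵀα_k = (eᵀα_k)² = 0. Self-adjointness makes α_jᵀα_k
-- constant along antidiagonals, and every antidiagonal meets either the diagonal or an
-- entry α_{k+1}ᵀα_k = α_{k+1}ᵀ(Aα_{k+1} − λα_{k+1}) = 0.

{-# OPTIONS --safe #-}
module Submission where

open import Defs
open import Level using (Level)
open import Data.Nat using (ℕ; suc)
open import Data.Nat.Divisibility using (_∣_)
open import Data.Fin using (Fin; zero)
open import Data.Product using (_,_)
open import Relation.Nullary using (¬_)

import Algebra.Properties.Group as GroupProperties
import Algebra.Properties.Monoid.Mult as MonoidMult
import Algebra.Properties.Semiring.Sum as SemiringSum
import Algebra.Solver.CommutativeMonoid as CommutativeMonoidSolver
open import Data.Bool using (Bool; true; false; if_then_else_; _≟_)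
open import Data.Fin using (suc; inject₁; fromℕ)
open import Data.Fin.Relation.Unary.Top using (View; view; ‵fromℕ; ‵inject₁)
open import Data.List using (length; filter; tabulate)
open import Data.Nat.Base as ℕ using ()
open import Data.Nat.Divisibility using (divides)
open import Function using (_∘_)
open import Relation.Binary.PropositionalEquality as ≡ using (_≡_)
import Relation.Binary.Reasoning.Setoid as SetoidReasoning

module _ {c ℓ : Level} (F : Field c ℓ) where
  open Field F hiding (zero)
  open LinAlg F hiding (Carrier; _≈_; _+_; _*_; 0#; 1#)
  open SetoidReasoning setoid
  private
    module Sum = SemiringSum semiring
  open MonoidMult +-monoid using (_×_; ×-assocˡ; ×-congʳ)
  open GroupProperties +-group using (∙-cancelˡ)

  ∑≡sum : ∀ {m} (f : Vector m) → ∑ f ≡ Sum.sum f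
  ∑≡sum {ℕ.zero} f = ≡.refl
  ∑≡sum {suc m}  f = ≡.cong (f zero +_) (∑≡sum (f ∘ suc))

  ∑-cong : ∀ {m} {f g : Vector m} → f ≈ᵛ g → ∑ f ≈ ∑ g
  ∑-cong {f = f} {g} f≈g = begin
    ∑ f        ≡⟨ ∑≡sum f ⟩
    Sum.sum f  ≈⟨ Sum.sum-cong-≋ f≈g ⟩
    Sum.sum g  ≡⟨ ∑≡sum g ⟨
    ∑ g        ∎

  ∑-zero : ∀ m → ∑ {m} (λ _ → 0#) ≈ 0#
  ∑-zero m = trans (reflexive (∑≡sum {m} _)) (Sum.sum-replicate-zero m)

  ∑-distrib-+ : ∀ {m} (f g : Vector m) → ∑ (λ i → f i + g i) ≈ ∑ f + ∑ g
  ∑-distrib-+ {m} f g = begin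
    ∑ (λ i → f i + g i)         ≡⟨ ∑≡sum {m} _ ⟩
    Sum.sum (λ i → f i + g i)   ≈⟨ Sum.∑-distrib-+ f g ⟩
    Sum.sum f + Sum.sum g       ≡⟨ ≡.cong₂ _+_ (∑≡sum f) (∑≡sum g) ⟨
    ∑ f + ∑ g                   ∎

  *-distribˡ-∑ : ∀ {m} a (f : Vector m) → a * ∑ f ≈ ∑ (λ i → a * f i)
  *-distribˡ-∑ {m} a f = begin
    a * ∑ f                    ≡⟨ ≡.cong (a *_) (∑≡sum f) ⟩
    a * Sum.sum f              ≈⟨ Sum.*-distribˡ-sum a f ⟩
    Sum.sum (λ i → a * f i)    ≡⟨ ∑≡sum {m} _ ⟨
    ∑ (λ i → a * f i)          ∎

  *-distribʳ-∑ : ∀ {m} a (f : Vector m) → ∑ f * a ≈ ∑ (λ i → f i * a)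
  *-distribʳ-∑ {m} a f = begin
    ∑ f * a                    ≡⟨ ≡.cong (_* a) (∑≡sum f) ⟩
    Sum.sum f * a              ≈⟨ Sum.*-distribʳ-sum a f ⟩
    Sum.sum (λ i → f i * a)    ≡⟨ ∑≡sum {m} _ ⟨
    ∑ (λ i → f i * a)          ∎

  ∑-comm : ∀ {m k} (f : Fin m → Fin k → Carrier) →
           ∑ (λ i → ∑ (λ j → f i j)) ≈ ∑ (λ j → ∑ (λ i → f i j))
  ∑-comm {m} {k} f = begin
    ∑ (λ i → ∑ (λ j → f i j))              ≡⟨ ∑∑≡sumsum {m} {k} f ⟩
    Sum.sum (λ i → Sum.sum (f i))          ≈⟨ Sum.∑-comm f ⟩
    Sum.sum (λ j → Sum.sum (λ i → f i j))  ≡⟨ ∑∑≡sumsum {k} {m} (λ j i → f i j) ⟨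
    ∑ (λ j → ∑ (λ i → f i j))              ∎
    where
    ∑∑≡sumsum : ∀ {m k} (g : Fin m → Fin k → Carrier) →
                ∑ (λ i → ∑ (g i)) ≡ Sum.sum (λ i → Sum.sum (g i))
    ∑∑≡sumsum {m} g = ≡.trans (∑≡sum {m} _) (Sum.sum-cong-≗ (λ i → ∑≡sum (g i)))

  dot-comm : ∀ {m} (x y : Vector m) → dot x y ≈ dot y x
  dot-comm {m} x y = ∑-cong {m} (λ i → *-comm (x i) (y i))

  dot-congʳ : ∀ {m} (x : Vector m) {y z : Vector m} → y ≈ᵛ z → dot x y ≈ dot x z
  dot-congʳ {m} x y≈z = ∑-cong {m} (λ i → *-congˡ (y≈z i))

  dot-scaleʳ : ∀ {m} (x : Vector m) a (y : Vector m) → dot x (a ·ᵛ y) ≈ a * dot x y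
  dot-scaleʳ {m} x a y = begin
    ∑ (λ i → x i * (a * y i))    ≈⟨ ∑-cong {m} (λ i → regroup (x i) (y i)) ⟩
    ∑ (λ i → a * (x i * y i))    ≈⟨ *-distribˡ-∑ {m} a _ ⟨
    a * dot x y                  ∎
    where
    open CommutativeMonoidSolver *-commutativeMonoid
    regroup : ∀ u v → u * (a * v) ≈ a * (u * v)
    regroup u v = solve 3 (λ u′ a′ v′ → u′ ⊕ (a′ ⊕ v′) ⊜ a′ ⊕ (u′ ⊕ v′)) refl u a v

  dot-linearʳ : ∀ {m} (x : Vector m) a (y z : Vector m) →
                dot x ((a ·ᵛ y) +ᵛ z) ≈ a * dot x y + dot x z
  dot-linearʳ {m} x a y z = begin
    ∑ (λ i → x i * (a * y i + z i))            ≈⟨ ∑-cong {m} (λ i → distribˡ (x i) _ _) ⟩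
    ∑ (λ i → x i * (a * y i) + x i * z i)      ≈⟨ ∑-distrib-+ {m} _ _ ⟩
    dot x (a ·ᵛ y) + dot x z                   ≈⟨ +-congʳ (dot-scaleʳ x a y) ⟩
    a * dot x y + dot x z                      ∎

  IsSymmetric : ∀ {m} → (Fin m → Fin m → Carrier) → Set ℓ
  IsSymmetric M = ∀ i j → M i j ≈ M j i

  ⊛-selfAdjoint : ∀ {m} {M : Fin m → Fin m → Carrier} → IsSymmetric M →
                  ∀ x y → dot x (M ⊛ y) ≈ dot (M ⊛ x) y
  ⊛-selfAdjoint {m} {M} M-sym x y = begin
    ∑ (λ i → x i * ∑ (λ j → M i j * y j))
      ≈⟨ ∑-cong {m} (λ i → *-distribˡ-∑ {m} (x i) _) ⟩
    ∑ (λ i → ∑ (λ j → x i * (M i j * y j)))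
      ≈⟨ ∑-comm {m} {m} _ ⟩
    ∑ (λ j → ∑ (λ i → x i * (M i j * y j)))
      ≈⟨ ∑-cong {m} (λ j → ∑-cong {m} (λ i → regroup i j)) ⟩
    ∑ (λ j → ∑ (λ i → (M j i * x i) * y j))
      ≈⟨ ∑-cong {m} (λ j → *-distribʳ-∑ {m} (y j) _) ⟨
    ∑ (λ j → ∑ (λ i → M j i * x i) * y j)
      ∎
    where
    open CommutativeMonoidSolver *-commutativeMonoid
    regroup : ∀ i j → x i * (M i j * y j) ≈ (M j i * x i) * y j
    regroup i j = trans (solve 3 (λ a b d → a ⊕ (b ⊕ d) ⊜ (b ⊕ a) ⊕ d) refl (x i) (M i j) (y j))
                        (*-congʳ (*-congʳ (M-sym i j)))

  dot-ones-⊛≈0 : ∀ {m} {M : Fin m → Fin m → Carrier} → IsSymmetric M →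
                 (M ⊛ ones) ≈ᵛ (λ _ → 0#) → ∀ x → dot ones (M ⊛ x) ≈ 0#
  dot-ones-⊛≈0 {m} {M} M-sym M⊛ones≈0 x = begin
    dot ones (M ⊛ x)      ≈⟨ ⊛-selfAdjoint M-sym ones x ⟩
    dot (M ⊛ ones) x      ≈⟨ ∑-cong {m} (λ i → trans (*-congʳ (M⊛ones≈0 i)) (zeroˡ (x i))) ⟩
    ∑ {m} (λ _ → 0#)      ≈⟨ ∑-zero m ⟩
    0#                    ∎

  nonzero*x≈0⇒x≈0 : ∀ {a x} → ¬ (a ≈ 0#) → a * x ≈ 0# → x ≈ 0#
  nonzero*x≈0⇒x≈0 {a} {x} a≉0 ax≈0 with inverse a a≉0
  ... | b , ab≈1 = begin
    x              ≈⟨ *-identityˡ x ⟨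
    1# * x         ≈⟨ *-congʳ ab≈1 ⟨
    (a * b) * x    ≈⟨ *-congʳ (*-comm a b) ⟩
    (b * a) * x    ≈⟨ *-assoc b a x ⟩
    b * (a * x)    ≈⟨ *-congˡ ax≈0 ⟩
    b * 0#         ≈⟨ zeroʳ b ⟩
    0#             ∎

  module _ (char2 : Char2) where

    x+x≈0 : ∀ x → x + x ≈ 0#
    x+x≈0 x = begin
      x + x              ≈⟨ +-cong (*-identityˡ x) (*-identityˡ x) ⟨
      1# * x + 1# * x    ≈⟨ distribʳ x 1# 1# ⟨
      (1# + 1#) * x      ≈⟨ *-congʳ char2 ⟩
      0# * x             ≈⟨ zeroˡ x ⟩
      0#                 ∎

    2∣⇒×≈0 : ∀ {k} x → 2 ∣ k → k × x ≈ 0#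
    2∣⇒×≈0 x (divides q ≡.refl) = begin
      (q ℕ.* 2) × x           ≈⟨ ×-assocˡ x q 2 ⟨
      q × (x + (x + 0#))      ≈⟨ ×-congʳ q (trans (+-congˡ (+-identityʳ x)) (x+x≈0 x)) ⟩
      q × 0#                  ≈⟨ Sum.sum-replicate q ⟨
      Sum.sum {q} (λ _ → 0#)  ≈⟨ Sum.sum-replicate-zero q ⟩
      0#                      ∎

    ∑∑-symmetric≈∑-diagonal : ∀ {m} (N : Fin m → Fin m → Carrier) → IsSymmetric N →
                              ∑ (λ i → ∑ (λ j → N i j)) ≈ ∑ (λ i → N i i)
    ∑∑-symmetric≈∑-diagonal {ℕ.zero} N N-sym = refl
    ∑∑-symmetric≈∑-diagonal {suc m}  N N-sym = begin
      (N zero zero + R) + ∑ (λ i → N (suc i) zero + ∑ (λ j → N (suc i) (suc j)))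
        ≈⟨ +-congˡ (∑-distrib-+ {m} _ _) ⟩
      (N zero zero + R) + (∑ (λ i → N (suc i) zero) + ∑ (λ i → ∑ (λ j → N (suc i) (suc j))))
        ≈⟨ +-congˡ (+-cong (∑-cong {m} (λ i → N-sym (suc i) zero))
                           (∑∑-symmetric≈∑-diagonal (λ i j → N (suc i) (suc j))
                                                    (λ i j → N-sym (suc i) (suc j)))) ⟩
      (N zero zero + R) + (R + D)
        ≈⟨ +-assoc _ R _ ⟩
      N zero zero + (R + (R + D))
        ≈⟨ +-congˡ (+-assoc R R D) ⟨
      N zero zero + ((R + R) + D)
        ≈⟨ +-congˡ (trans (+-congʳ (x+x≈0 R)) (+-identityˡ D)) ⟩
      N zero zero + D
        ∎
      where
      R = ∑ (λ j → N zero (suc j))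
      D = ∑ (λ i → N (suc i) (suc i))

    dot-self≈∑² : ∀ {m} (x : Vector m) → dot x x ≈ ∑ x * ∑ x
    dot-self≈∑² {m} x = begin
      ∑ (λ i → x i * x i)
        ≈⟨ ∑∑-symmetric≈∑-diagonal (λ i j → x i * x j) (λ i j → *-comm (x i) (x j)) ⟨
      ∑ (λ i → ∑ (λ j → x i * x j))
        ≈⟨ ∑-cong {m} (λ i → *-distribˡ-∑ {m} (x i) x) ⟨
      ∑ (λ i → x i * ∑ x)
        ≈⟨ *-distribʳ-∑ {m} (∑ x) x ⟨
      ∑ x * ∑ x
        ∎

    ⊛-alternating : ∀ {m} {M : Fin m → Fin m → Carrier} → IsSymmetric M → (∀ i → M i i ≈ 0#) →
                    ∀ x → dot x (M ⊛ x) ≈ 0#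
    ⊛-alternating {m} {M} M-sym M-diag x = begin
      ∑ (λ i → x i * ∑ (λ j → M i j * x j))
        ≈⟨ ∑-cong {m} (λ i → *-distribˡ-∑ {m} (x i) _) ⟩
      ∑ (λ i → ∑ (λ j → x i * (M i j * x j)))
        ≈⟨ ∑∑-symmetric≈∑-diagonal _ swap ⟩
      ∑ (λ i → x i * (M i i * x i))
        ≈⟨ ∑-cong {m} (λ i → trans (*-congˡ (diagonal≈0 i)) (zeroʳ _)) ⟩
      ∑ {m} (λ _ → 0#)
        ≈⟨ ∑-zero m ⟩
      0#
        ∎
      where
      open CommutativeMonoidSolver *-commutativeMonoid
      diagonal≈0 : ∀ i → M i i * x i ≈ 0#
      diagonal≈0 i = trans (*-congʳ (M-diag i)) (zeroˡ (x i))

      swap : ∀ i j → x i * (M i j * x j) ≈ x j * (M j i * x i)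
      swap i j = trans (solve 3 (λ a b d → a ⊕ (b ⊕ d) ⊜ d ⊕ (b ⊕ a)) refl (x i) (M i j) (x j))
                       (*-congˡ (*-congʳ (M-sym i j)))

  adjMatrix-symmetric : ∀ {n} (G : SimpleGraph n) → IsSymmetric (adjMatrix G)
  adjMatrix-symmetric G i j rewrite SimpleGraph.symm G i j = refl

  adjMatrix-diagonal≈0 : ∀ {n} (G : SimpleGraph n) i → adjMatrix G i i ≈ 0#
  adjMatrix-diagonal≈0 G i rewrite SimpleGraph.irrefl G i = refl

  ∑-indicator≈length-filter : ∀ {m} {A : Set} (h : Fin m → A) (P : A → Bool) →
                              ∑ (λ i → if P (h i) then 1# else 0#) ≈
                              length (filter (λ a → P a ≟ true) (tabulate h)) × 1#
  ∑-indicator≈length-filter {ℕ.zero} h P = refl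
  ∑-indicator≈length-filter {suc m}  h P with P (h zero)
  ... | true  = +-congˡ (∑-indicator≈length-filter (h ∘ suc) P)
  ... | false = trans (+-identityˡ _) (∑-indicator≈length-filter (h ∘ suc) P)

  adjMatrix-⊛-ones≈degree : ∀ {n} (G : SimpleGraph n) i → (adjMatrix G ⊛ ones) i ≈ degree G i × 1#
  adjMatrix-⊛-ones≈degree {n} G i =
    trans (∑-cong {n} (λ j → *-identityʳ _)) (∑-indicator≈length-filter (λ j → j) (SimpleGraph.adj G i))

  evenDegrees⇒adjMatrix-⊛-ones≈0 : Char2 → ∀ {n} (G : SimpleGraph n) → (∀ i → 2 ∣ degree G i) →
                                   (adjMatrix G ⊛ ones) ≈ᵛ (λ _ → 0#)
  evenDegrees⇒adjMatrix-⊛-ones≈0 char2 G even i =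
    trans (adjMatrix-⊛-ones≈degree G i) (2∣⇒×≈0 char2 1# (even i))

  IsJordanChain-inject₁ : ∀ {n} {M : Fin n → Fin n → Carrier} {l m} (α : Fin (suc (suc m)) → Vector n) →
                          IsJordanChain M l α → IsJordanChain M l (α ∘ inject₁)
  IsJordanChain-inject₁ α (head , next) = head , next ∘ inject₁

  module _ {n} {M : Fin n → Fin n → Carrier} (M-sym : IsSymmetric M) {l : Carrier} where

    dot-⊛-head : ∀ {m} (α : Fin (suc m) → Vector n) → IsJordanChain M l α →
                 ∀ x → dot x (M ⊛ α zero) ≈ l * dot x (α zero)
    dot-⊛-head α (head , _) x = trans (dot-congʳ x head) (dot-scaleʳ x l _)

    dot-⊛-step : ∀ {m} (α : Fin (suc m) → Vector n) → IsJordanChain M l α →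
                 ∀ x b → dot x (M ⊛ α (suc b)) ≈ l * dot x (α (suc b)) + dot x (α (inject₁ b))
    dot-⊛-step α (_ , next) x b = trans (dot-congʳ x (next b)) (dot-linearʳ x l _ _)

    jordanChain-hankel : ∀ {m} (α : Fin (suc m) → Vector n) → IsJordanChain M l α → ∀ a b →
                         dot (α (suc a)) (α (inject₁ b)) ≈ dot (α (inject₁ a)) (α (suc b))
    jordanChain-hankel α jc a b = ∙-cancelˡ (l * Q (suc a) (suc b)) _ _ (begin
      l * Q (suc a) (suc b) + Q (suc a) (inject₁ b)  ≈⟨ dot-⊛-step α jc (α (suc a)) b ⟨
      dot (α (suc a)) (M ⊛ α (suc b))                ≈⟨ ⊛-selfAdjoint M-sym _ _ ⟩
      dot (M ⊛ α (suc a)) (α (suc b))                ≈⟨ dot-comm (M ⊛ α (suc a)) (α (suc b)) ⟩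
      dot (α (suc b)) (M ⊛ α (suc a))                ≈⟨ dot-⊛-step α jc (α (suc b)) a ⟩
      l * Q (suc b) (suc a) + Q (suc b) (inject₁ a)  ≈⟨ +-cong (*-congˡ (dot-comm (α (suc b)) (α (suc a))))
                                                                 (dot-comm (α (suc b)) (α (inject₁ a))) ⟩
      l * Q (suc a) (suc b) + Q (inject₁ a) (suc b)  ∎)
      where
      Q = λ i j → dot (α i) (α j)

    module _ (M⊛ones≈0 : (M ⊛ ones) ≈ᵛ (λ _ → 0#)) (l≉0 : ¬ (l ≈ 0#)) where

      jordanChain-ones⊥ : ∀ {m} (α : Fin (suc m) → Vector n) → IsJordanChain M l α →
                          ∀ j → dot ones (α j) ≈ 0#
      jordanChain-ones⊥ α jc zero =
        nonzero*x≈0⇒x≈0 l≉0 (trans (sym (dot-⊛-head α jc ones)) (dot-ones-⊛≈0 M-sym M⊛ones≈0 _))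
      jordanChain-ones⊥ {suc m} α jc (suc k) = nonzero*x≈0⇒x≈0 l≉0 (begin
        l * dot ones (α (suc k))                              ≈⟨ +-identityʳ _ ⟨
        l * dot ones (α (suc k)) + 0#                         ≈⟨ +-congˡ prefix⊥ones ⟨
        l * dot ones (α (suc k)) + dot ones (α (inject₁ k))   ≈⟨ dot-⊛-step α jc ones k ⟨
        dot ones (M ⊛ α (suc k))                              ≈⟨ dot-ones-⊛≈0 M-sym M⊛ones≈0 _ ⟩
        0#                                                    ∎)
        where
        prefix⊥ones : dot ones (α (inject₁ k)) ≈ 0#
        prefix⊥ones = jordanChain-ones⊥ (α ∘ inject₁) (IsJordanChain-inject₁ α jc) k

      module _ (char2 : Char2) where

        jordanChain-dot-self≈0 : ∀ {m} (α : Fin (suc m) → Vector n) → IsJordanChain M l α →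
                                 ∀ j → dot (α j) (α j) ≈ 0#
        jordanChain-dot-self≈0 α jc j = begin
          dot (α j) (α j)       ≈⟨ dot-self≈∑² char2 (α j) ⟩
          ∑ (α j) * ∑ (α j)     ≈⟨ *-congʳ ∑αj≈0 ⟩
          0# * ∑ (α j)          ≈⟨ zeroˡ _ ⟩
          0#                    ∎
          where
          ∑αj≈0 : ∑ (α j) ≈ 0#
          ∑αj≈0 = trans (∑-cong {n} (λ i → sym (*-identityˡ (α j i)))) (jordanChain-ones⊥ α jc j)

        module _ (M-diag : ∀ i → M i i ≈ 0#) where

          jordanChain-dot-suc-inject₁≈0 : ∀ {m} (α : Fin (suc m) → Vector n) → IsJordanChain M l α →
                                          ∀ b → dot (α (suc b)) (α (inject₁ b)) ≈ 0#
          jordanChain-dot-suc-inject₁≈0 α jc b = begin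
            Q (suc b) (inject₁ b)                              ≈⟨ +-identityˡ _ ⟨
            0# + Q (suc b) (inject₁ b)                         ≈⟨ +-congʳ l*Q≈0 ⟨
            l * Q (suc b) (suc b) + Q (suc b) (inject₁ b)      ≈⟨ dot-⊛-step α jc (α (suc b)) b ⟨
            dot (α (suc b)) (M ⊛ α (suc b))                    ≈⟨ ⊛-alternating char2 M-sym M-diag _ ⟩
            0#                                                 ∎
            where
            Q = λ i j → dot (α i) (α j)
            l*Q≈0 : l * Q (suc b) (suc b) ≈ 0#
            l*Q≈0 = trans (*-congˡ (jordanChain-dot-self≈0 α jc (suc b))) (zeroʳ l)

          jordanChain-last⊥prefix : ∀ {m} (α : Fin (suc (suc m)) → Vector n) → IsJordanChain M l α →
                                    (∀ j k → dot (α (inject₁ j)) (α (inject₁ k)) ≈ 0#) →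
                                    ∀ k → dot (α (fromℕ (suc m))) (α (inject₁ k)) ≈ 0#
          jordanChain-last⊥prefix {m} α jc prefix⊥ k with view k
          ... | ‵fromℕ      = jordanChain-dot-suc-inject₁≈0 α jc (fromℕ m)
          ... | ‵inject₁ k′ =
            trans (jordanChain-hankel α jc (fromℕ m) (inject₁ k′)) (prefix⊥ (fromℕ m) (suc k′))

          jordanChain-isotropic : ∀ {m} (α : Fin (suc m) → Vector n) → IsJordanChain M l α →
                                  ∀ j k → dot (α j) (α k) ≈ 0#
          jordanChain-isotropic {ℕ.zero} α jc zero zero = jordanChain-dot-self≈0 α jc zero
          jordanChain-isotropic {suc m} α jc j k = byLastView (view j) (view k)
            where
            prefix⊥ : ∀ j k → dot (α (inject₁ j)) (α (inject₁ k)) ≈ 0#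
            prefix⊥ = jordanChain-isotropic (α ∘ inject₁) (IsJordanChain-inject₁ α jc)

            last⊥prefix : ∀ k → dot (α (fromℕ (suc m))) (α (inject₁ k)) ≈ 0#
            last⊥prefix = jordanChain-last⊥prefix α jc prefix⊥

            byLastView : ∀ {j k} → View j → View k → dot (α j) (α k) ≈ 0#
            byLastView ‵fromℕ        ‵fromℕ        = jordanChain-dot-self≈0 α jc (fromℕ (suc m))
            byLastView ‵fromℕ        (‵inject₁ k′) = last⊥prefix k′
            byLastView (‵inject₁ j′) ‵fromℕ        = trans (dot-comm (α (inject₁ j′)) _) (last⊥prefix j′)
            byLastView (‵inject₁ j′) (‵inject₁ k′) = prefix⊥ j′ k′

lemma9 : ∀ {c ℓ} (F : Field c ℓ) → let open LinAlg F in
         Char2 →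
         (n : ℕ) → 2 ∣ n →
         (G : SimpleGraph n) → Eulerian G →
         (t : ℕ) (ℓs : Fin (suc t) → ℕ) (λs : Fin (suc t) → Carrier)
         (α : (i : Fin (suc t)) → Fin (suc (ℓs i)) → Vector n) →
         Invertible ℓs (λ { (i , k) → α i k }) →
         (∀ i → IsJordanChain (adjMatrix G) (λs i) (α i)) →
         α zero zero ≈ᵛ ones →
         ∀ i → ¬ (λs i ≈ 0#) →
         ∀ j k → dot (α i j) (α i k) ≈ 0#
lemma9 F char2 _ _ G (_ , evenDegrees) _ _ _ α _ isJordanChain _ i λᵢ≉0 =
  jordanChain-isotropic F (adjMatrix-symmetric F G)
    (evenDegrees⇒adjMatrix-⊛-ones≈0 F char2 G evenDegrees) λᵢ≉0
    char2 (adjMatrix-diagonal≈0 F G)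
    (α i) (isJordanChain i)
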